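{- Let $J_1$ and $J_2$ be two graphs and $S$ a finite set. Then in $R_S$, \[ \tilde{\jmath}(J_1,S; x)\,\tilde{\jmath}(J_2,S; x)= \sum_{I\subseteq V(J_1)}\ \sum_{\lambda \in \mathrm{inj}(I, V(J_2))} \tilde{\jmath}(J_{I,\lambda},S; x),\] where $J_{I,\lambda}$ is the graph obtained as follows: start with the disjoint union of $J_1$ and $J_2$, and then identify $v$ in $J_1$ with $\lambda(v)$ in $J_2$ for all $v\in I$; if there are any double edges after the identifications, then both of the edges are removed.
   Context: All graphs are finite and simple. For a finite set $S$, $E(K_S)$ is the set of 2-element subsets of $S$, and $R_S=\mathbb{R}[x_e \mid e\in E(K_S)]/\langle x_e^2-1 \mid e\in E(K_S)\rangle$; we write $x_{ab}$ for $x_{\{a,b\}}$. $\mathrm{inj}(A,B)$ is the set of injective maps $A\to B$. For an injection $\phi$ and an edge $e=uv$, $x_{\phi(e)}$ means $x_{\phi(u)\phi(v)}$. For a graph $J$ and set $S$, \[ \tilde{\jmath}(J,S;x) = \sum_{\phi \in \mathrm{inj}(V(J),S)} \prod_{e\in E(J)} x_{\phi(e)} \in R_S. \] -}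

module Defs where

open import Level using (Level)
open import Algebra.Bundles using (CommutativeRing)
open import Data.Nat using (ℕ; zero; suc; _≡ᵇ_; _<ᵇ_)
import Data.Nat as ℕ
open import Data.Fin using (Fin; zero; suc; toℕ; join)
open import Data.Fin.Properties using (_≟_; all?)
open import Data.Bool using (Bool; true; false; if_then_else_; _∧_)
open import Data.Maybe using (Maybe; just; nothing)
open import Data.Sum using (_⊎_; inj₁; inj₂)
import Data.Sum as Sum
open import Data.List using (List; []; _∷_; map; allFin)
open import Relation.Binary.PropositionalEquality using (_≡_)
open import Relation.Nullary using (Dec; does)
open import Relation.Nullary.Decidable using (_→-dec_)

record Graph : Set where
  field
    size       : ℕ
    adj        : Fin size → Fin size → Bool
    adj-sym    : ∀ i j → adj i j ≡ adj j i
    adj-irrefl : ∀ i → adj i i ≡ false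

Injective : {m n : ℕ} → (Fin m → Fin n) → Set
Injective φ = ∀ i j → φ i ≡ φ j → i ≡ j

injective? : {m n : ℕ} → (φ : Fin m → Fin n) → Dec (Injective φ)
injective? φ = all? λ i → all? λ j → (φ i ≟ φ j) →-dec (i ≟ j)

-- A partial map Fin m1 ⇀ Fin m2 (defined on I = {v | p v ≢ nothing})
-- is injective on its domain.
PInjective : {m1 m2 : ℕ} → (Fin m1 → Maybe (Fin m2)) → Set
PInjective {m2 = m2} p = ∀ i j (w : Fin m2) → p i ≡ just w → p j ≡ just w → i ≡ j

pinjective? : {m1 m2 : ℕ} → (p : Fin m1 → Maybe (Fin m2)) → Dec (PInjective p)
pinjective? p = all? λ i → all? λ j → all? λ w →
  eqJust (p i) w →-dec (eqJust (p j) w →-dec (i ≟ j))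
  where
  eqJust : ∀ {k} (a : Maybe (Fin k)) (w : Fin k) → Dec (a ≡ just w)
  eqJust (just a) w with a ≟ w
  ... | Relation.Nullary.yes Relation.Binary.PropositionalEquality.refl = Relation.Nullary.yes Relation.Binary.PropositionalEquality.refl
  ... | Relation.Nullary.no ¬p = Relation.Nullary.no λ { Relation.Binary.PropositionalEquality.refl → ¬p Relation.Binary.PropositionalEquality.refl }
  eqJust nothing w = Relation.Nullary.no λ ()

countFin : (k : ℕ) → (Fin k → Bool) → ℕ
countFin zero    f = zero
countFin (suc k) f = (if f zero then 1 else 0) ℕ.+ countFin k (λ i → f (suc i))

sumℕ : (k : ℕ) → (Fin k → ℕ) → ℕ
sumℕ zero    f = zero
sumℕ (suc k) f = f zero ℕ.+ sumℕ k (λ i → f (suc i))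

countPairs : (k : ℕ) → (Fin k → Fin k → Bool) → ℕ
countPairs k f = sumℕ k (λ u → countFin k (f u))

-- The partial injection p encodes (I, λ):
-- I = {v | p v ≢ nothing}, λ v = w when p v = just w.
-- Vertex set: V(J₂) ⊎ (V(J₁) ∖ I) = Fin m2 ⊎ Fin (unmatched p),
-- realised as Fin (m2 + unmatched p).

unmatched : {m1 m2 : ℕ} → (Fin m1 → Maybe (Fin m2)) → ℕ
unmatched {zero}   p = zero
unmatched {suc m1} p with p zero
... | just _  = unmatched (λ i → p (suc i))
... | nothing = suc (unmatched (λ i → p (suc i)))

-- where each vertex of J₁ goes in the disjoint union after identification
glue₀ : {m1 m2 : ℕ} → (p : Fin m1 → Maybe (Fin m2)) → Fin m1 → Fin m2 ⊎ Fin (unmatched p)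
glue₀ {suc m1} p i with p zero
glue₀ {suc m1} p zero    | just w  = inj₁ w
glue₀ {suc m1} p (suc i) | just _  = glue₀ (λ j → p (suc j)) i
glue₀ {suc m1} p zero    | nothing = inj₂ zero
glue₀ {suc m1} p (suc i) | nothing = Sum.map (λ w → w) suc (glue₀ (λ j → p (suc j)) i)

gluedSize : (J₁ J₂ : Graph) → (Fin (Graph.size J₁) → Maybe (Fin (Graph.size J₂))) → ℕ
gluedSize J₁ J₂ p = Graph.size J₂ ℕ.+ unmatched p

ι₁ : (J₁ J₂ : Graph) → (p : Fin (Graph.size J₁) → Maybe (Fin (Graph.size J₂))) →
     Fin (Graph.size J₁) → Fin (gluedSize J₁ J₂ p)
ι₁ J₁ J₂ p v = join (Graph.size J₂) (unmatched p) (glue₀ p v)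

ι₂ : (J₁ J₂ : Graph) → (p : Fin (Graph.size J₁) → Maybe (Fin (Graph.size J₂))) →
     Fin (Graph.size J₂) → Fin (gluedSize J₁ J₂ p)
ι₂ J₁ J₂ p w = join (Graph.size J₂) (unmatched p) (inj₁ w)

-- number of edges (of the multigraph J₁ ⊔ J₂ after identification)
-- going from a to b
multiplicity : (J₁ J₂ : Graph) → (p : Fin (Graph.size J₁) → Maybe (Fin (Graph.size J₂))) →
               Fin (gluedSize J₁ J₂ p) → Fin (gluedSize J₁ J₂ p) → ℕ
multiplicity J₁ J₂ p a b =
    countPairs (Graph.size J₁) (λ u v →
      Graph.adj J₁ u v ∧ does (ι₁ J₁ J₂ p u ≟ a) ∧ does (ι₁ J₁ J₂ p v ≟ b))
  ℕ.+ countPairs (Graph.size J₂) (λ u v →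
      Graph.adj J₂ u v ∧ does (ι₂ J₁ J₂ p u ≟ a) ∧ does (ι₂ J₁ J₂ p v ≟ b))

-- keep exactly the simple edges; double edges are removed
gluedAdj : (J₁ J₂ : Graph) → (p : Fin (Graph.size J₁) → Maybe (Fin (Graph.size J₂))) →
           Fin (gluedSize J₁ J₂ p) → Fin (gluedSize J₁ J₂ p) → Bool
gluedAdj J₁ J₂ p a b = multiplicity J₁ J₂ p a b ≡ᵇ 1

module _ {c ℓ : Level} (R : CommutativeRing c ℓ) where
  open CommutativeRing R using (Carrier; _+_; _*_; 0#; 1#)

  sumList : {B : Set} → (B → Carrier) → List B → Carrier
  sumList f []       = 0#
  sumList f (b ∷ bs) = f b + sumList f bs

  prodFin : (k : ℕ) → (Fin k → Carrier) → Carrier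
  prodFin zero    f = 1#
  prodFin (suc k) f = f zero * prodFin k (λ i → f (suc i))

  -- sum over all functions Fin m → B, where the list enumerates B
  sumFuns : {B : Set} → (m : ℕ) → List B → ((Fin m → B) → Carrier) → Carrier
  sumFuns zero    L f = f (λ ())
  sumFuns (suc m) L f = sumList (λ b → sumFuns m L (λ g → f (cons b g))) L
    where
    cons : {B : Set} → B → (Fin m → B) → Fin (suc m) → B
    cons b g zero    = b
    cons b g (suc i) = g i

  edgeProd : (n : ℕ) → (Fin n → Fin n → Carrier) →
             (m : ℕ) → (Fin m → Fin m → Bool) → (Fin m → Fin n) → Carrier
  edgeProd n x m adj φ = prodFin m λ u → prodFin m λ v →
    if (toℕ u <ᵇ toℕ v) ∧ adj u v then x (φ u) (φ v) else 1#

  jRaw : (n : ℕ) → (Fin n → Fin n → Carrier) →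
         (m : ℕ) → (Fin m → Fin m → Bool) → Carrier
  jRaw n x m adj = sumFuns m (allFin n) λ φ →
    if does (injective? φ) then edgeProd n x m adj φ else 0#

  j̃ : (J : Graph) → (n : ℕ) → (Fin n → Fin n → Carrier) → Carrier
  j̃ J n x = jRaw n x (Graph.size J) (Graph.adj J)

  -- right-hand side: ∑_{I ⊆ V(J₁)} ∑_{λ ∈ inj(I, V(J₂))} j̃(J_{I,λ}, S; x),
  -- the pair (I, λ) being encoded as a partial injection V(J₁) ⇀ V(J₂)
  glueSum : (J₁ J₂ : Graph) → (n : ℕ) → (Fin n → Fin n → Carrier) → Carrier
  glueSum J₁ J₂ n x =
    sumFuns (Graph.size J₁) (nothing ∷ map just (allFin (Graph.size J₂))) λ p →
      if does (pinjective? p)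
      then jRaw n x (gluedSize J₁ J₂ p) (gluedAdj J₁ J₂ p)
      else 0#

-- Both sides are sums over pairs (φ₁ , φ₂) of maps V(J₁) → S,
-- V(J₂) → S: on the left trivially, on the right because a term (p , ψ),
-- p a partial injection V(J₁) ⇀ V(J₂) encoding (I , λ) and ψ a map of the
-- glued graph, restricts to (ψ ∘ ι₁ , ψ ∘ ι₂).  For fixed (φ₁ , φ₂):
--  * (correspondence) if φ₁ and φ₂ are injective, exactly one injective
--    (p , ψ) restricts to them: p matches v with w when φ₁ v = φ₂ w, and ψ is
--    the amalgam of φ₁ and φ₂; otherwise no injective (p , ψ) does;
--  * (multiplicativity) for that term the edge product of ψ is the product of
--    those of φ₁ and φ₂: every edge product is ∏_{c<d} x_cd^N(c,d), N(c,d)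
--    the number of edges mapped onto {c , d}; the glued graph has the parity
--    of the counts of J₁ and J₂, which is all that matters since x_cd² = 1.
module Submission where

open import Defs
open import Level using (Level; _⊔_)
open import Algebra.Bundles using (CommutativeRing)
import Data.Nat as ℕ
open import Data.Nat using (ℕ; zero; suc; _≤_; z≤n; s≤s; _≡ᵇ_; _<ᵇ_)
import Data.Nat.Properties as ℕₚ
open import Data.Fin using (Fin; zero; suc; toℕ; join; splitAt)
open import Data.Fin.Properties
  using (_≟_; any?; all?; suc-injective; 0≢1+n; toℕ-injective; splitAt-join; join-splitAt)
open import Data.Bool using (Bool; true; false; if_then_else_; _∧_; not)
open import Data.Bool.Properties using (∧-comm; ∧-conicalˡ; ∧-conicalʳ; ∧-identityʳ; ∧-zeroʳ; ¬-not)
open import Data.Maybe using (Maybe; just; nothing)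
open import Data.Maybe.Properties using (just-injective)
open import Data.Sum using (_⊎_; inj₁; inj₂; [_,_]′)
import Data.Sum as Sum
open import Data.Sum.Properties using (inj₁-injective; inj₂-injective)
open import Data.Product using (_×_; _,_; ∃; proj₁; proj₂)
open import Data.List using (List; []; _∷_; map; allFin; tabulate)
open import Data.List.Properties using (map-tabulate)
open import Data.Empty using (⊥; ⊥-elim)
open import Function using (id; _∘_; case_of_)
open import Relation.Nullary using (¬_; Dec; yes; no; does)
open import Relation.Nullary.Decidable using (dec-true; dec-false)
open import Relation.Binary.PropositionalEquality
  using (_≡_; _≢_; _≗_; refl; sym; trans; cong; cong₂; subst; module ≡-Reasoning)
import Algebra.Properties.CommutativeMonoid.Sum as MonoidSum

does-sound : ∀ {p} {A : Set p} (d : Dec A) → does d ≡ true → A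
does-sound (yes a) _ = a

indicator : Bool → ℕ
indicator b = if b then 1 else 0

indicator≤1 : ∀ b → indicator b ≤ 1
indicator≤1 true  = s≤s z≤n
indicator≤1 false = z≤n

sumℕ-cong : (k : ℕ) {f g : Fin k → ℕ} → (∀ i → f i ≡ g i) → sumℕ k f ≡ sumℕ k g
sumℕ-cong zero    e = refl
sumℕ-cong (suc k) e = cong₂ ℕ._+_ (e zero) (sumℕ-cong k (e ∘ suc))

sumℕ-zero : (k : ℕ) {f : Fin k → ℕ} → (∀ i → f i ≡ 0) → sumℕ k f ≡ 0
sumℕ-zero zero    e = refl
sumℕ-zero (suc k) e rewrite e zero = sumℕ-zero k (e ∘ suc)

sumℕ-single : (k : ℕ) (f : Fin k → ℕ) (i₀ : Fin k) → (∀ i → i ≢ i₀ → f i ≡ 0) → sumℕ k f ≡ f i₀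
sumℕ-single (suc k) f zero     e =
  trans (cong (f zero ℕ.+_) (sumℕ-zero k (λ i → e (suc i) λ ()))) (ℕₚ.+-identityʳ _)
sumℕ-single (suc k) f (suc i₀) e rewrite e zero (λ ()) =
  sumℕ-single k (f ∘ suc) i₀ (λ i i≢i₀ → e (suc i) (i≢i₀ ∘ suc-injective))

-- sumℕ is the library's finite sum over the monoid (ℕ, +, 0), so its
-- interchange law is inherited.
module ℕ-Sum = MonoidSum ℕₚ.+-0-commutativeMonoid

sumℕ≡∑ : (k : ℕ) (f : Fin k → ℕ) → sumℕ k f ≡ ℕ-Sum.sum f
sumℕ≡∑ zero    f = refl
sumℕ≡∑ (suc k) f = cong (f zero ℕ.+_) (sumℕ≡∑ k (f ∘ suc))

sumℕ-comm : (k l : ℕ) (g : Fin k → Fin l → ℕ) →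
  sumℕ k (λ u → sumℕ l (g u)) ≡ sumℕ l (λ v → sumℕ k (λ u → g u v))
sumℕ-comm k l g = begin
  sumℕ k (λ u → sumℕ l (g u))
    ≡⟨ trans (sumℕ-cong k (λ u → sumℕ≡∑ l (g u))) (sumℕ≡∑ k _) ⟩
  ℕ-Sum.sum (λ u → ℕ-Sum.sum (g u))
    ≡⟨ ℕ-Sum.∑-comm g ⟩
  ℕ-Sum.sum (λ v → ℕ-Sum.sum (λ u → g u v))
    ≡⟨ sym (trans (sumℕ-cong l (λ v → sumℕ≡∑ k _)) (sumℕ≡∑ l _)) ⟩
  sumℕ l (λ v → sumℕ k (λ u → g u v))          ∎
  where open ≡-Reasoning

countFin≡sumℕ : (k : ℕ) (f : Fin k → Bool) → countFin k f ≡ sumℕ k (indicator ∘ f)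
countFin≡sumℕ zero    f = refl
countFin≡sumℕ (suc k) f = cong (indicator (f zero) ℕ.+_) (countFin≡sumℕ k (f ∘ suc))

countFin-none : (k : ℕ) (f : Fin k → Bool) → (∀ i → f i ≡ false) → countFin k f ≡ 0
countFin-none k f e = trans (countFin≡sumℕ k f) (sumℕ-zero k (cong indicator ∘ e))

countFin-single : (k : ℕ) (f : Fin k → Bool) (i₀ : Fin k) → (∀ i → f i ≡ true → i ≡ i₀) →
  countFin k f ≡ indicator (f i₀)
countFin-single k f i₀ e = trans (countFin≡sumℕ k f) (sumℕ-single k _ i₀ off)
  where
  off : ∀ i → i ≢ i₀ → indicator (f i) ≡ 0
  off i i≢i₀ = cong indicator (¬-not (i≢i₀ ∘ e i))

countPairs-cong : (k : ℕ) {f g : Fin k → Fin k → Bool} → (∀ u v → f u v ≡ g u v) →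
  countPairs k f ≡ countPairs k g
countPairs-cong k e = sumℕ-cong k (λ u → trans (countFin≡sumℕ k _)
  (trans (sumℕ-cong k (cong indicator ∘ e u)) (sym (countFin≡sumℕ k _))))

countPairs-none : (k : ℕ) (f : Fin k → Fin k → Bool) → (∀ u v → f u v ≡ false) → countPairs k f ≡ 0
countPairs-none k f e = sumℕ-zero k (λ u → countFin-none k (f u) (e u))

countPairs-single : (k : ℕ) (f : Fin k → Fin k → Bool) (u₀ v₀ : Fin k) →
  (∀ u v → f u v ≡ true → u ≡ u₀ × v ≡ v₀) → countPairs k f ≡ indicator (f u₀ v₀)
countPairs-single k f u₀ v₀ e =
  trans (sumℕ-single k _ u₀ (λ u u≢u₀ → countFin-none k (f u) (off u u≢u₀)))
        (countFin-single k (f u₀) v₀ (λ v fv → proj₂ (e u₀ v fv)))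
  where
  off : ∀ u → u ≢ u₀ → ∀ v → f u v ≡ false
  off u u≢u₀ v = ¬-not (u≢u₀ ∘ proj₁ ∘ e u v)

countPairs-≤1 : (k : ℕ) (f : Fin k → Fin k → Bool) →
  (∀ u v u' v' → f u v ≡ true → f u' v' ≡ true → u ≡ u' × v ≡ v') → countPairs k f ≤ 1
countPairs-≤1 k f e with any? (λ u → any? (λ v → f u v Data.Bool.≟ true))
... | yes (u₀ , v₀ , f₀) =
  subst (_≤ 1) (sym (countPairs-single k f u₀ v₀ (λ u v fuv → e u v u₀ v₀ fuv f₀))) (indicator≤1 _)
... | no nothing-holds =
  subst (_≤ 1) (sym (countPairs-none k f (λ u v → ¬-not (λ fuv → nothing-holds (u , v , fuv))))) z≤n

countPairs-transpose : (k : ℕ) (f : Fin k → Fin k → Bool) →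
  countPairs k (λ u v → f v u) ≡ countPairs k f
countPairs-transpose k f =
  trans (sumℕ-cong k (λ u → countFin≡sumℕ k _))
  (trans (sumℕ-comm k k _)
         (sym (sumℕ-cong k (λ u → countFin≡sumℕ k _))))

-- The number of ordered edges (u , v) of the graph (k , A) lying over the
-- pair (c , d) along a vertex map φ.  The multiplicity of an edge of a glued
-- graph is the sum of two such counts.
fibreCount : (k : ℕ) (A : Fin k → Fin k → Bool) {l : ℕ} (φ : Fin k → Fin l) (c d : Fin l) → ℕ
fibreCount k A φ c d = countPairs k (λ u v → A u v ∧ does (φ u ≟ c) ∧ does (φ v ≟ d))

module _ (k : ℕ) (A : Fin k → Fin k → Bool) {l : ℕ} where

  lies-over : (φ : Fin k → Fin l) {c d : Fin l} {u v : Fin k} →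
    (A u v ∧ does (φ u ≟ c) ∧ does (φ v ≟ d)) ≡ true → φ u ≡ c × φ v ≡ d
  lies-over φ {c} {d} {u} {v} e =
    let rest = ∧-conicalʳ (A u v) _ e in
    does-sound (φ u ≟ c) (∧-conicalˡ _ _ rest) , does-sound (φ v ≟ d) (∧-conicalʳ _ _ rest)

  fibreCount-transpose : (∀ u v → A u v ≡ A v u) → (φ : Fin k → Fin l) (c d : Fin l) →
    fibreCount k A φ d c ≡ fibreCount k A φ c d
  fibreCount-transpose A-sym φ c d =
    trans (sym (countPairs-transpose k _)) (countPairs-cong k reorder)
    where
    reorder : ∀ u v →
      (A v u ∧ does (φ v ≟ d) ∧ does (φ u ≟ c)) ≡ (A u v ∧ does (φ u ≟ c) ∧ does (φ v ≟ d))
    reorder u v rewrite A-sym v u | ∧-comm (does (φ v ≟ d)) (does (φ u ≟ c)) = refl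

  fibreCount-≤1 : (φ : Fin k → Fin l) → Injective φ → (c d : Fin l) → fibreCount k A φ c d ≤ 1
  fibreCount-≤1 φ φ-inj c d = countPairs-≤1 k _ λ u v u' v' e e' →
    let (φu , φv) = lies-over φ e ; (φu' , φv') = lies-over φ e' in
    φ-inj u u' (trans φu (sym φu')) , φ-inj v v' (trans φv (sym φv'))

  fibreCount-∘ : {l' : ℕ} (ψ : Fin l → Fin l') → Injective ψ → (φ : Fin k → Fin l) (a b : Fin l) →
    fibreCount k A (ψ ∘ φ) (ψ a) (ψ b) ≡ fibreCount k A φ a b
  fibreCount-∘ ψ ψ-inj φ a b = countPairs-cong k λ u v →
    cong₂ (λ s t → A u v ∧ s ∧ t) (same (φ u) a) (same (φ v) b)
    where
    same : ∀ i j → does (ψ i ≟ ψ j) ≡ does (i ≟ j)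
    same i j with i ≟ j
    ... | yes refl = dec-true (ψ i ≟ ψ i) refl
    ... | no  i≢j  = dec-false (ψ i ≟ ψ j) (i≢j ∘ ψ-inj i j)

  fibreCount-outside : (φ : Fin k → Fin l) (c d : Fin l) →
    (∀ u → φ u ≢ c) ⊎ (∀ v → φ v ≢ d) → fibreCount k A φ c d ≡ 0
  fibreCount-outside φ c d outside =
    countPairs-none k _ λ u v → ¬-not λ e → missed outside (lies-over φ e)
    where
    missed : ∀ {u v} → (∀ u → φ u ≢ c) ⊎ (∀ v → φ v ≢ d) → ¬ (φ u ≡ c × φ v ≡ d)
    missed (inj₁ c-missed) (φu , _) = c-missed _ φu
    missed (inj₂ d-missed) (_ , φv) = d-missed _ φv

fibreCount-id : (k : ℕ) (A : Fin k → Fin k → Bool) (a b : Fin k) →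
  fibreCount k A id a b ≡ indicator (A a b)
fibreCount-id k A a b =
  trans (countPairs-single k _ a b (λ u v e → lies-over k A id e))
        (cong indicator (trans (cong₂ (λ s t → A a b ∧ s ∧ t) (dec-true (a ≟ a) refl) (dec-true (b ≟ b) refl))
                               (∧-identityʳ (A a b))))

glue₀-matched : {m1 m2 : ℕ} (p : Fin m1 → Maybe (Fin m2)) (v : Fin m1) (w : Fin m2) →
  p v ≡ just w → glue₀ p v ≡ inj₁ w
glue₀-matched {suc m1} p v w e with p zero in p0
glue₀-matched {suc m1} p zero    w e | just w' = cong inj₁ (just-injective (trans (sym p0) e))
glue₀-matched {suc m1} p (suc v) w e | just _  = glue₀-matched (p ∘ suc) v w e
glue₀-matched {suc m1} p zero    w e | nothing with () ← trans (sym p0) e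
glue₀-matched {suc m1} p (suc v) w e | nothing = cong (Sum.map id suc) (glue₀-matched (p ∘ suc) v w e)

glue₀-inj₁ : {m1 m2 : ℕ} (p : Fin m1 → Maybe (Fin m2)) (v : Fin m1) (w : Fin m2) →
  glue₀ p v ≡ inj₁ w → p v ≡ just w
glue₀-inj₁ {suc m1} p v w e with p zero in p0
glue₀-inj₁ {suc m1} p zero    w refl | just _  = p0
glue₀-inj₁ {suc m1} p (suc v) w e    | just _  = glue₀-inj₁ (p ∘ suc) v w e
glue₀-inj₁ {suc m1} p (suc v) w e    | nothing with glue₀ (p ∘ suc) v in g
glue₀-inj₁ {suc m1} p (suc v) w refl | nothing | inj₁ _ = glue₀-inj₁ (p ∘ suc) v w g

unmatchedVertex : {m1 m2 : ℕ} (p : Fin m1 → Maybe (Fin m2)) → Fin (unmatched p) → Fin m1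
unmatchedVertex {suc m1} p k with p zero
unmatchedVertex {suc m1} p k       | just _  = suc (unmatchedVertex (p ∘ suc) k)
unmatchedVertex {suc m1} p zero    | nothing = zero
unmatchedVertex {suc m1} p (suc k) | nothing = suc (unmatchedVertex (p ∘ suc) k)

glue₀-unmatchedVertex : {m1 m2 : ℕ} (p : Fin m1 → Maybe (Fin m2)) (k : Fin (unmatched p)) →
  glue₀ p (unmatchedVertex p k) ≡ inj₂ k
glue₀-unmatchedVertex {suc m1} p k with p zero
glue₀-unmatchedVertex {suc m1} p k       | just _  = glue₀-unmatchedVertex (p ∘ suc) k
glue₀-unmatchedVertex {suc m1} p zero    | nothing = refl
glue₀-unmatchedVertex {suc m1} p (suc k) | nothing =
  cong (Sum.map id suc) (glue₀-unmatchedVertex (p ∘ suc) k)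

glue₀-inj₂ : {m1 m2 : ℕ} (p : Fin m1 → Maybe (Fin m2)) (v : Fin m1) (k : Fin (unmatched p)) →
  glue₀ p v ≡ inj₂ k → v ≡ unmatchedVertex p k
glue₀-inj₂ {suc m1} p v k e with p zero
glue₀-inj₂ {suc m1} p (suc v) k       e    | just _  = cong suc (glue₀-inj₂ (p ∘ suc) v k e)
glue₀-inj₂ {suc m1} p zero    zero    e    | nothing = refl
glue₀-inj₂ {suc m1} p (suc v) k       e    | nothing with glue₀ (p ∘ suc) v in g
glue₀-inj₂ {suc m1} p (suc v) (suc k) refl | nothing | inj₂ k' = cong suc (glue₀-inj₂ (p ∘ suc) v k' g)

glue₀-injective : {m1 m2 : ℕ} (p : Fin m1 → Maybe (Fin m2)) → PInjective p →
  ∀ v v' → glue₀ p v ≡ glue₀ p v' → v ≡ v'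
glue₀-injective p p-inj v v' e with glue₀ p v in g | glue₀ p v' in g'
glue₀-injective p p-inj v v' refl | inj₁ w | inj₁ .w =
  p-inj v v' w (glue₀-inj₁ p v w g) (glue₀-inj₁ p v' w g')
glue₀-injective p p-inj v v' refl | inj₂ k | inj₂ .k =
  trans (glue₀-inj₂ p v k g) (sym (glue₀-inj₂ p v' k g'))

join-injective : (m n : ℕ) (a b : Fin m ⊎ Fin n) → join m n a ≡ join m n b → a ≡ b
join-injective m n a b e =
  trans (sym (splitAt-join m n a)) (trans (cong (splitAt m) e) (splitAt-join m n b))

ι₁-injective : (J₁ J₂ : Graph) (p : Fin (Graph.size J₁) → Maybe (Fin (Graph.size J₂))) →
  PInjective p → Injective (ι₁ J₁ J₂ p)
ι₁-injective J₁ J₂ p p-inj v v' e =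
  glue₀-injective p p-inj v v' (join-injective (Graph.size J₂) (unmatched p) _ _ e)

ι₂-injective : (J₁ J₂ : Graph) (p : Fin (Graph.size J₁) → Maybe (Fin (Graph.size J₂))) →
  Injective (ι₂ J₁ J₂ p)
ι₂-injective J₁ J₂ p w w' e = inj₁-injective (join-injective (Graph.size J₂) (unmatched p) _ _ e)

module BigOperators {c ℓ : Level} (R : CommutativeRing c ℓ) where
  open CommutativeRing R hiding (zero) renaming (refl to ≈-refl; sym to ≈-sym; trans to ≈-trans)
  open import Algebra.Properties.CommutativeSemigroup +-commutativeSemigroup using (interchange)
  open import Algebra.Properties.CommutativeSemigroup *-commutativeSemigroup
    using () renaming (interchange to *-interchange)
  open import Algebra.Properties.Semiring.Exp semiring using (_^_; ^-homo-*)

  sumList-cong : {B : Set} (L : List B) {f g : B → Carrier} → (∀ b → f b ≈ g b) →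
    sumList R f L ≈ sumList R g L
  sumList-cong []      e = ≈-refl
  sumList-cong (b ∷ L) e = +-cong (e b) (sumList-cong L e)

  sumList-zero : {B : Set} (L : List B) {f : B → Carrier} → (∀ b → f b ≈ 0#) → sumList R f L ≈ 0#
  sumList-zero []      e = ≈-refl
  sumList-zero (b ∷ L) e = ≈-trans (+-cong (e b) (sumList-zero L e)) (+-identityˡ 0#)

  sumList-+ : {B : Set} (L : List B) (f g : B → Carrier) →
    sumList R (λ b → f b + g b) L ≈ sumList R f L + sumList R g L
  sumList-+ []      f g = ≈-sym (+-identityˡ 0#)
  sumList-+ (b ∷ L) f g = ≈-trans (+-congˡ (sumList-+ L f g)) (interchange (f b) (g b) _ _)

  sumList-*ˡ : {B : Set} (L : List B) (a : Carrier) (f : B → Carrier) →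
    a * sumList R f L ≈ sumList R (λ b → a * f b) L
  sumList-*ˡ []      a f = zeroʳ a
  sumList-*ˡ (b ∷ L) a f = ≈-trans (distribˡ a (f b) _) (+-congˡ (sumList-*ˡ L a f))

  sumFuns-cong : {B : Set} (m : ℕ) (L : List B) {f g : (Fin m → B) → Carrier} →
    (∀ φ → f φ ≈ g φ) → sumFuns R m L f ≈ sumFuns R m L g
  sumFuns-cong zero    L e = e _
  sumFuns-cong (suc m) L e = sumList-cong L (λ b → sumFuns-cong m L (λ φ → e _))

  sumFuns-zero : {B : Set} (m : ℕ) (L : List B) {f : (Fin m → B) → Carrier} →
    (∀ φ → f φ ≈ 0#) → sumFuns R m L f ≈ 0#
  sumFuns-zero zero    L e = e _
  sumFuns-zero (suc m) L e = sumList-zero L (λ b → sumFuns-zero m L (λ φ → e _))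

  sumFuns-+ : {B : Set} (m : ℕ) (L : List B) (f g : (Fin m → B) → Carrier) →
    sumFuns R m L (λ φ → f φ + g φ) ≈ sumFuns R m L f + sumFuns R m L g
  sumFuns-+ zero    L f g = ≈-refl
  sumFuns-+ (suc m) L f g = ≈-trans (sumList-cong L (λ b → sumFuns-+ m L _ _)) (sumList-+ L _ _)

  sumFuns-*ˡ : {B : Set} (m : ℕ) (L : List B) (a : Carrier) (f : (Fin m → B) → Carrier) →
    a * sumFuns R m L f ≈ sumFuns R m L (λ φ → a * f φ)
  sumFuns-*ˡ zero    L a f = ≈-refl
  sumFuns-*ˡ (suc m) L a f = ≈-trans (sumList-*ˡ L a _) (sumList-cong L (λ b → sumFuns-*ˡ m L a _))

  sumFuns-*ʳ : {B : Set} (m : ℕ) (L : List B) (a : Carrier) (f : (Fin m → B) → Carrier) →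
    sumFuns R m L f * a ≈ sumFuns R m L (λ φ → f φ * a)
  sumFuns-*ʳ m L a f =
    ≈-trans (*-comm _ a) (≈-trans (sumFuns-*ˡ m L a f) (sumFuns-cong m L (λ φ → *-comm a (f φ))))

  sumList-sumFuns : {A B : Set} (L : List A) (m : ℕ) (L' : List B) (h : A → (Fin m → B) → Carrier) →
    sumList R (λ a → sumFuns R m L' (h a)) L ≈ sumFuns R m L' (λ φ → sumList R (λ a → h a φ) L)
  sumList-sumFuns []      m L' h = ≈-sym (sumFuns-zero m L' (λ φ → ≈-refl))
  sumList-sumFuns (a ∷ L) m L' h =
    ≈-trans (+-congˡ (sumList-sumFuns L m L' h)) (≈-sym (sumFuns-+ m L' (h a) _))

  sumFuns-comm : {A B : Set} (m : ℕ) (L : List A) (m' : ℕ) (L' : List B)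
    (h : (Fin m → A) → (Fin m' → B) → Carrier) →
    sumFuns R m L (λ φ → sumFuns R m' L' (h φ)) ≈ sumFuns R m' L' (λ ψ → sumFuns R m L (λ φ → h φ ψ))
  sumFuns-comm zero    L m' L' h = ≈-refl
  sumFuns-comm (suc m) L m' L' h =
    ≈-trans (sumList-cong L (λ b → sumFuns-comm m L m' L' _)) (sumList-sumFuns L m' L' _)

  -- L enumerates B without repetition: summing a function that vanishes
  -- off one point b₀ gives its value at b₀.
  SumsDeltas : {B : Set} → List B → Set (c ⊔ ℓ)
  SumsDeltas {B} L = ∀ (f : B → Carrier) (b₀ : B) → (∀ b → b ≢ b₀ → f b ≈ 0#) → sumList R f L ≈ f b₀

  tabulate-zero : {B : Set} (k : ℕ) (g : Fin k → B) (f : B → Carrier) →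
    (∀ i → f (g i) ≈ 0#) → sumList R f (tabulate g) ≈ 0#
  tabulate-zero zero    g f e = ≈-refl
  tabulate-zero (suc k) g f e =
    ≈-trans (+-cong (e zero) (tabulate-zero k (g ∘ suc) f (e ∘ suc))) (+-identityˡ 0#)

  tabulate-delta : {B : Set} (k : ℕ) (g : Fin k → B) → (∀ i j → g i ≡ g j → i ≡ j) →
    (f : B → Carrier) (i₀ : Fin k) → (∀ b → b ≢ g i₀ → f b ≈ 0#) → sumList R f (tabulate g) ≈ f (g i₀)
  tabulate-delta (suc k) g g-inj f zero off =
    ≈-trans (+-congˡ (tabulate-zero k (g ∘ suc) f (λ i → off _ (λ e → 0≢1+n (g-inj _ _ (sym e))))))
            (+-identityʳ _)
  tabulate-delta (suc k) g g-inj f (suc i₀) off =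
    ≈-trans (+-cong (off _ (λ e → 0≢1+n (g-inj _ _ e)))
                    (tabulate-delta k (g ∘ suc) (λ i j e → suc-injective (g-inj _ _ e)) f i₀ off))
            (+-identityˡ _)

  tabulate-sumsDeltas : {B : Set} (k : ℕ) (g : Fin k → B) → (∀ i j → g i ≡ g j → i ≡ j) →
    (∀ b → ∃ λ i → g i ≡ b) → SumsDeltas (tabulate g)
  tabulate-sumsDeltas k g g-inj g-onto f b₀ off with g-onto b₀
  ... | i₀ , refl = tabulate-delta k g g-inj f i₀ off

  allFin-sumsDeltas : (n : ℕ) → SumsDeltas (allFin n)
  allFin-sumsDeltas n = tabulate-sumsDeltas n id (λ i j e → e) (λ b → b , refl)

  maybeFin-sumsDeltas : (n : ℕ) → SumsDeltas (nothing ∷ map just (allFin n))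
  maybeFin-sumsDeltas n = subst SumsDeltas (sym (cong (nothing ∷_) (map-tabulate id just)))
    (tabulate-sumsDeltas (suc n) option option-injective option-onto)
    where
    option : Fin (suc n) → Maybe (Fin n)
    option zero    = nothing
    option (suc i) = just i
    option-injective : ∀ i j → option i ≡ option j → i ≡ j
    option-injective zero    zero    _ = refl
    option-injective (suc i) (suc j) e = cong suc (just-injective e)
    option-onto : ∀ b → ∃ λ i → option i ≡ b
    option-onto nothing  = zero , refl
    option-onto (just w) = suc w , refl

  sumFuns-delta : {B : Set} (m : ℕ) (L : List B) → SumsDeltas L →
    (g : Fin m → B) (h : (Fin m → B) → Carrier) (X : Carrier) →
    (∀ φ → φ ≗ g → h φ ≈ X) → (∀ φ → ¬ (φ ≗ g) → h φ ≈ 0#) → sumFuns R m L h ≈ X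
  sumFuns-delta zero    L deltas g h X at-g off-g = at-g _ (λ ())
  sumFuns-delta (suc m) L deltas g h X at-g off-g =
    ≈-trans (deltas _ (g zero) (λ b b≢g0 → sumFuns-zero m L (λ φ → off-g _ (λ e → b≢g0 (e zero)))))
            (sumFuns-delta m L deltas (g ∘ suc) _ X
               (λ φ e → at-g _ (λ { zero → refl ; (suc i) → e i }))
               (λ φ ne → off-g _ (λ e → ne (e ∘ suc))))

  prodFin-cong : (k : ℕ) {f g : Fin k → Carrier} → (∀ i → f i ≈ g i) → prodFin R k f ≈ prodFin R k g
  prodFin-cong zero    e = ≈-refl
  prodFin-cong (suc k) e = *-cong (e zero) (prodFin-cong k (e ∘ suc))

  prodFin-one : (k : ℕ) {f : Fin k → Carrier} → (∀ i → f i ≈ 1#) → prodFin R k f ≈ 1#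
  prodFin-one zero    e = ≈-refl
  prodFin-one (suc k) e = ≈-trans (*-cong (e zero) (prodFin-one k (e ∘ suc))) (*-identityˡ 1#)

  prodFin-* : (k : ℕ) (f g : Fin k → Carrier) →
    prodFin R k (λ i → f i * g i) ≈ prodFin R k f * prodFin R k g
  prodFin-* zero    f g = ≈-sym (*-identityˡ 1#)
  prodFin-* (suc k) f g = ≈-trans (*-congˡ (prodFin-* k _ _)) (*-interchange (f zero) (g zero) _ _)

  prodFin-comm : (k l : ℕ) (f : Fin k → Fin l → Carrier) →
    prodFin R k (λ u → prodFin R l (f u)) ≈ prodFin R l (λ v → prodFin R k (λ u → f u v))
  prodFin-comm zero    l f = ≈-sym (prodFin-one l (λ v → ≈-refl))
  prodFin-comm (suc k) l f = ≈-trans (*-congˡ (prodFin-comm k l _)) (≈-sym (prodFin-* l _ _))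

  prodFin-select : (k : ℕ) (a : Fin k) (Y : Carrier) →
    prodFin R k (λ c → if does (a ≟ c) then Y else 1#) ≈ Y
  prodFin-select (suc k) zero    Y = ≈-trans (*-congˡ (prodFin-one k (λ i → ≈-refl))) (*-identityʳ Y)
  prodFin-select (suc k) (suc a) Y =
    ≈-trans (*-identityˡ _) (≈-trans (prodFin-cong k shift) (prodFin-select k a Y))
    where
    shift : ∀ i → (if does (suc a ≟ suc i) then Y else 1#) ≈ (if does (a ≟ i) then Y else 1#)
    shift i with a ≟ i
    ... | yes refl = ≈-refl
    ... | no  _    = ≈-refl

  prodFin-count : (k : ℕ) (f : Fin k → Bool) (y : Carrier) →
    prodFin R k (λ u → if f u then y else 1#) ≈ y ^ countFin k f
  prodFin-count zero    f y = ≈-refl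
  prodFin-count (suc k) f y with f zero
  ... | true  = *-congˡ (prodFin-count k (f ∘ suc) y)
  ... | false = ≈-trans (*-identityˡ _) (prodFin-count k (f ∘ suc) y)

  prodFin-^ : (k : ℕ) (g : Fin k → ℕ) (y : Carrier) → prodFin R k (λ u → y ^ g u) ≈ y ^ sumℕ k g
  prodFin-^ zero    g y = ≈-refl
  prodFin-^ (suc k) g y = ≈-trans (*-congˡ (prodFin-^ k (g ∘ suc) y)) (≈-sym (^-homo-* y (g zero) _))

  ∏∏ : (k : ℕ) → (Fin k → Fin k → Carrier) → Carrier
  ∏∏ k F = prodFin R k (λ u → prodFin R k (F u))

  ∏∏-cong : (k : ℕ) {F G : Fin k → Fin k → Carrier} → (∀ u v → F u v ≈ G u v) → ∏∏ k F ≈ ∏∏ k G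
  ∏∏-cong k e = prodFin-cong k (λ u → prodFin-cong k (e u))

  ∏∏-* : (k : ℕ) (F G : Fin k → Fin k → Carrier) → ∏∏ k (λ u v → F u v * G u v) ≈ ∏∏ k F * ∏∏ k G
  ∏∏-* k F G = ≈-trans (prodFin-cong k (λ u → prodFin-* k _ _)) (prodFin-* k _ _)

  ∏∏-transpose : (k : ℕ) (F : Fin k → Fin k → Carrier) → ∏∏ k (λ u v → F v u) ≈ ∏∏ k F
  ∏∏-transpose k F = prodFin-comm k k (λ u v → F v u)

  ∏∏-count : (k : ℕ) (f : Fin k → Fin k → Bool) (y : Carrier) →
    ∏∏ k (λ u v → if f u v then y else 1#) ≈ y ^ countPairs k f
  ∏∏-count k f y = ≈-trans (prodFin-cong k (λ u → prodFin-count k (f u) y)) (prodFin-^ k _ y)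

  guard : ∀ {p} {A : Set p} → Dec A → Carrier → Carrier
  guard d y = if does d then y else 0#

  guard-yes : ∀ {p} {A : Set p} (d : Dec A) {y : Carrier} → A → guard d y ≈ y
  guard-yes (yes _) _ = ≈-refl
  guard-yes (no ¬a) a = ⊥-elim (¬a a)

  guard-zero : ∀ {p} {A : Set p} (d : Dec A) {y : Carrier} → (A → y ≈ 0#) → guard d y ≈ 0#
  guard-zero (yes a) y≈0 = y≈0 a
  guard-zero (no _)  _   = ≈-refl

  guard-sumFuns : ∀ {p} {A : Set p} {B : Set} (d : Dec A) (m : ℕ) (L : List B)
    (f : (Fin m → B) → Carrier) →
    guard d (sumFuns R m L f) ≈ sumFuns R m L (guard d ∘ f)
  guard-sumFuns (yes _) m L f = ≈-refl
  guard-sumFuns (no _)  m L f = ≈-sym (sumFuns-zero m L (λ φ → ≈-refl))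

IsOrientation : (k : ℕ) → (Fin k → Fin k → Bool) → Set
IsOrientation k s = (∀ u → s u u ≡ false) × (∀ u v → u ≢ v → s v u ≡ not (s u v))

<ᵇ-irrefl : ∀ a → (a <ᵇ a) ≡ false
<ᵇ-irrefl zero    = refl
<ᵇ-irrefl (suc a) = <ᵇ-irrefl a

<ᵇ-flip : ∀ a b → a ≢ b → (b <ᵇ a) ≡ not (a <ᵇ b)
<ᵇ-flip zero    zero    a≢b = ⊥-elim (a≢b refl)
<ᵇ-flip zero    (suc b) _   = refl
<ᵇ-flip (suc a) zero    _   = refl
<ᵇ-flip (suc a) (suc b) a≢b = <ᵇ-flip a b (a≢b ∘ cong suc)

-- The order of Fin l pulled back along φ: u before v iff φ u < φ v.  For
-- φ = id this is the order in which edgeProd counts each edge once.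
pulledOrder : {k l : ℕ} → (Fin k → Fin l) → Fin k → Fin k → Bool
pulledOrder φ u v = toℕ (φ u) <ᵇ toℕ (φ v)

pulledOrder-orientation : {k l : ℕ} (φ : Fin k → Fin l) → Injective φ → IsOrientation k (pulledOrder φ)
pulledOrder-orientation φ φ-inj =
  (λ u → <ᵇ-irrefl (toℕ (φ u))) ,
  (λ u v u≢v → <ᵇ-flip (toℕ (φ u)) (toℕ (φ v)) (u≢v ∘ φ-inj u v ∘ toℕ-injective))

_∩_ _∖_ : {k : ℕ} → (Fin k → Fin k → Bool) → (Fin k → Fin k → Bool) → Fin k → Fin k → Bool
(s ∩ t) u v = s u v ∧ t u v
(s ∖ t) u v = s u v ∧ not (t u v)

orientation-mismatch : {k : ℕ} {s t : Fin k → Fin k → Bool} → IsOrientation k s → IsOrientation k t →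
  ∀ u v → (s ∖ t) v u ≡ (t ∖ s) u v
orientation-mismatch {s = s} {t} (s-irr , s-flip) (t-irr , t-flip) u v with u ≟ v
... | yes refl rewrite s-irr u | t-irr u = refl
... | no u≢v rewrite s-flip u v u≢v | t-flip u v u≢v = mismatch (s u v) (t u v)
  where
  mismatch : ∀ a b → (not a ∧ not (not b)) ≡ (b ∧ not a)
  mismatch true  b     = sym (∧-zeroʳ b)
  mismatch false true  = refl
  mismatch false false = refl

module EdgeProducts {c ℓ : Level} (R : CommutativeRing c ℓ) where
  open CommutativeRing R hiding (zero) renaming (refl to ≈-refl; sym to ≈-sym; trans to ≈-trans)
  open BigOperators R
  open import Algebra.Properties.Semiring.Exp semiring using (_^_)
  open import Relation.Binary.Reasoning.Setoid setoid

  selected : {k : ℕ} → (Fin k → Fin k → Bool) → (Fin k → Fin k → Carrier) → Fin k → Fin k → Carrier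
  selected s Y u v = if s u v then Y u v else 1#

  selected-split : (k : ℕ) (s t : Fin k → Fin k → Bool) (Y : Fin k → Fin k → Carrier) →
    ∏∏ k (selected s Y) ≈ ∏∏ k (selected (s ∩ t) Y) * ∏∏ k (selected (s ∖ t) Y)
  selected-split k s t Y = ≈-trans (∏∏-cong k split) (∏∏-* k _ _)
    where
    split : ∀ u v → selected s Y u v ≈ selected (s ∩ t) Y u v * selected (s ∖ t) Y u v
    split u v with s u v | t u v
    ... | true  | true  = ≈-sym (*-identityʳ _)
    ... | true  | false = ≈-sym (*-identityˡ _)
    ... | false | _     = ≈-sym (*-identityˡ _)

  reorient : (k : ℕ) {s t : Fin k → Fin k → Bool} → IsOrientation k s → IsOrientation k t →
    (Y : Fin k → Fin k → Carrier) → (∀ u v → Y v u ≈ Y u v) → ∏∏ k (selected s Y) ≈ ∏∏ k (selected t Y)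
  reorient k {s} {t} s-or t-or Y Y-sym = begin
    ∏∏ k (selected s Y)                                      ≈⟨ selected-split k s t Y ⟩
    ∏∏ k (selected (s ∩ t) Y) * ∏∏ k (selected (s ∖ t) Y)
      ≈⟨ *-cong (∏∏-cong k (λ u v → reflexive (cong (λ b → if b then Y u v else 1#) (∧-comm (s u v) (t u v)))))
                (≈-trans (≈-sym (∏∏-transpose k _)) (∏∏-cong k backwards)) ⟩
    ∏∏ k (selected (t ∩ s) Y) * ∏∏ k (selected (t ∖ s) Y)
      ≈⟨ ≈-sym (selected-split k t s Y) ⟩
    ∏∏ k (selected t Y)                                      ∎
    where
    backwards : ∀ u v → selected (s ∖ t) Y v u ≈ selected (t ∖ s) Y u v
    backwards u v rewrite orientation-mismatch s-or t-or u v with (t ∖ s) u v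
    ... | true  = Y-sym u v
    ... | false = ≈-refl

  if-prodFin : (k : ℕ) (b : Bool) (G : Fin k → Carrier) →
    (if b then prodFin R k G else 1#) ≈ prodFin R k (λ v → if b then G v else 1#)
  if-prodFin k true  G = ≈-refl
  if-prodFin k false G = ≈-sym (prodFin-one k (λ _ → ≈-refl))

  over : {k l : ℕ} → (Fin k → Fin l) → Fin k → Fin l → Carrier → Carrier
  over φ u c y = if does (φ u ≟ c) then y else 1#

  prodFin-fibres : (k l : ℕ) (φ : Fin k → Fin l) (F : Fin k → Carrier) →
    prodFin R k F ≈ prodFin R l (λ c → prodFin R k (λ u → over φ u c (F u)))
  prodFin-fibres k l φ F =
    ≈-sym (≈-trans (prodFin-comm l k _) (prodFin-cong k (λ u → prodFin-select l (φ u) (F u))))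

  ∏∏-fibres : (k l : ℕ) (φ : Fin k → Fin l) (F : Fin k → Fin k → Carrier) →
    ∏∏ k F ≈ ∏∏ l (λ c d → ∏∏ k (λ u v → over φ u c (over φ v d (F u v))))
  ∏∏-fibres k l φ F = begin
    ∏∏ k F
      ≈⟨ prodFin-cong k (λ u → prodFin-fibres k l φ (F u)) ⟩
    prodFin R k (λ u → prodFin R l (λ d → prodFin R k (λ v → over φ v d (F u v))))
      ≈⟨ prodFin-comm k l _ ⟩
    prodFin R l (λ d → prodFin R k (λ u → prodFin R k (λ v → over φ v d (F u v))))
      ≈⟨ prodFin-cong l (λ d → prodFin-fibres k l φ _) ⟩
    prodFin R l (λ d → prodFin R l (λ c → prodFin R k (λ u → over φ u c (prodFin R k (λ v → over φ v d (F u v))))))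
      ≈⟨ prodFin-comm l l _ ⟩
    prodFin R l (λ c → prodFin R l (λ d → prodFin R k (λ u → over φ u c (prodFin R k (λ v → over φ v d (F u v))))))
      ≈⟨ prodFin-cong l (λ c → prodFin-cong l (λ d → prodFin-cong k (λ u → if-prodFin k _ _))) ⟩
    ∏∏ l (λ c d → ∏∏ k (λ u v → over φ u c (over φ v d (F u v))))  ∎

  edgeProd-cong : (n : ℕ) (x : Fin n → Fin n → Carrier) (k : ℕ) (A : Fin k → Fin k → Bool)
    {φ φ' : Fin k → Fin n} → φ ≗ φ' → edgeProd R n x k A φ ≈ edgeProd R n x k A φ'
  edgeProd-cong n x k A e = ∏∏-cong k λ u v →
    reflexive (cong₂ (λ a b → if (toℕ u <ᵇ toℕ v) ∧ A u v then x a b else 1#) (e u) (e v))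

  -- x_cd above the diagonal (c < d) and 1 elsewhere, so that each unordered
  -- pair of points contributes its variable once.
  upper : (n : ℕ) → (Fin n → Fin n → Carrier) → Fin n → Fin n → Carrier
  upper n x c d = if toℕ c <ᵇ toℕ d then x c d else 1#

  module _ (n : ℕ) (x : Fin n → Fin n → Carrier) (x-sym : ∀ a b → x a b ≈ x b a) where

    edgeProd-fibres : (k : ℕ) (A : Fin k → Fin k → Bool) → (∀ u v → A u v ≡ A v u) →
      (φ : Fin k → Fin n) → Injective φ →
      edgeProd R n x k A φ ≈ ∏∏ n (λ c d → upper n x c d ^ fibreCount k A φ c d)
    edgeProd-fibres k A A-sym φ φ-inj = begin
      edgeProd R n x k A φ
        ≈⟨ ∏∏-cong k (λ u v → select-edge (pulledOrder id u v) (A u v)) ⟩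
      ∏∏ k (selected (pulledOrder id) Y)
        ≈⟨ reorient k (pulledOrder-orientation id (λ _ _ e → e)) (pulledOrder-orientation φ φ-inj) Y Y-sym ⟩
      ∏∏ k (selected (pulledOrder φ) Y)
        ≈⟨ ∏∏-cong k (λ u v → order-inside (pulledOrder φ u v) (A u v)) ⟩
      ∏∏ k (λ u v → if A u v then upper n x (φ u) (φ v) else 1#)
        ≈⟨ ∏∏-fibres k n φ _ ⟩
      ∏∏ n (λ c d → ∏∏ k (λ u v → over φ u c (over φ v d (if A u v then upper n x (φ u) (φ v) else 1#))))
        ≈⟨ ∏∏-cong n (λ c d → ∏∏-cong k (collect c d)) ⟩
      ∏∏ n (λ c d → ∏∏ k (λ u v → if A u v ∧ does (φ u ≟ c) ∧ does (φ v ≟ d) then upper n x c d else 1#))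
        ≈⟨ ∏∏-cong n (λ c d → ∏∏-count k _ (upper n x c d)) ⟩
      ∏∏ n (λ c d → upper n x c d ^ fibreCount k A φ c d) ∎
      where
      Y : Fin k → Fin k → Carrier
      Y u v = if A u v then x (φ u) (φ v) else 1#

      Y-sym : ∀ u v → Y v u ≈ Y u v
      Y-sym u v rewrite A-sym v u with A u v
      ... | true  = x-sym (φ v) (φ u)
      ... | false = ≈-refl

      select-edge : ∀ {y} s a → (if s ∧ a then y else 1#) ≈ (if s then (if a then y else 1#) else 1#)
      select-edge true  a = ≈-refl
      select-edge false a = ≈-refl

      order-inside : ∀ {y} t a →
        (if t then (if a then y else 1#) else 1#) ≈ (if a then (if t then y else 1#) else 1#)
      order-inside true  a     = ≈-refl
      order-inside false true  = ≈-refl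
      order-inside false false = ≈-refl

      collect : ∀ c d u v → over φ u c (over φ v d (if A u v then upper n x (φ u) (φ v) else 1#))
                            ≈ (if A u v ∧ does (φ u ≟ c) ∧ does (φ v ≟ d) then upper n x c d else 1#)
      collect c d u v with φ u ≟ c | φ v ≟ d | A u v
      ... | yes refl | yes refl | true  = ≈-refl
      ... | yes refl | yes refl | false = ≈-refl
      ... | yes refl | no _     | true  = ≈-refl
      ... | yes refl | no _     | false = ≈-refl
      ... | no _     | _        | true  = ≈-refl
      ... | no _     | _        | false = ≈-refl

-- An edge of J_{I,λ} over (c , d) has multiplicity
-- N₁ + N₂ ≤ 2 and is kept iff that multiplicity is 1; since upper(c,d)² = 1
-- only the parity of the exponent matters.
module Gluing {c ℓ : Level} (R : CommutativeRing c ℓ) {n : ℕ} (x : Fin n → Fin n → CommutativeRing.Carrier R)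
  (x-sym : ∀ a b → CommutativeRing._≈_ R (x a b) (x b a))
  (x-sq : ∀ a b → a ≢ b → CommutativeRing._≈_ R (CommutativeRing._*_ R (x a b) (x a b)) (CommutativeRing.1# R))
  (J₁ J₂ : Graph) (p : Fin (Graph.size J₁) → Maybe (Fin (Graph.size J₂))) (p-inj : PInjective p) where
  open CommutativeRing R hiding (zero) renaming (refl to ≈-refl; sym to ≈-sym; trans to ≈-trans)
  open BigOperators R
  open EdgeProducts R
  open import Algebra.Properties.Semiring.Exp semiring using (_^_; ^-homo-*)
  open import Relation.Binary.Reasoning.Setoid setoid

  parity : (y : Carrier) → y * y ≈ 1# → (M : ℕ) → M ≤ 2 → y ^ M ≈ y ^ indicator (M ≡ᵇ 1)
  parity y y²≈1 zero                _ = ≈-refl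
  parity y y²≈1 (suc zero)          _ = ≈-refl
  parity y y²≈1 (suc (suc zero))    _ = ≈-trans (*-congˡ (*-identityʳ y)) y²≈1
  parity y y²≈1 (suc (suc (suc M))) (s≤s (s≤s ()))

  z : Fin n → Fin n → Carrier
  z = upper n x

  -- z c d is 1 or x_cd with c ≢ d, so it squares to 1.
  z-square : ∀ c d → z c d * z c d ≈ 1#
  z-square c d with toℕ c <ᵇ toℕ d in c<d
  ... | true  = x-sq c d λ { refl → case trans (sym c<d) (<ᵇ-irrefl (toℕ c)) of λ () }
  ... | false = *-identityˡ 1#

  m1 m2 : ℕ
  m1 = Graph.size J₁
  m2 = Graph.size J₂

  A₁ : Fin m1 → Fin m1 → Bool
  A₁ = Graph.adj J₁
  A₂ : Fin m2 → Fin m2 → Bool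
  A₂ = Graph.adj J₂

  G : ℕ
  G = gluedSize J₁ J₂ p
  Ag : Fin G → Fin G → Bool
  Ag = gluedAdj J₁ J₂ p
  i₁ : Fin m1 → Fin G
  i₁ = ι₁ J₁ J₂ p
  i₂ : Fin m2 → Fin G
  i₂ = ι₂ J₁ J₂ p

  -- The multiplicity of a glued edge is, by definition, the sum of the fibre
  -- counts of J₁ along ι₁ and of J₂ along ι₂; each is at most 1.
  multiplicity≤2 : ∀ a b → multiplicity J₁ J₂ p a b ≤ 2
  multiplicity≤2 a b = ℕₚ.+-mono-≤ (fibreCount-≤1 m1 A₁ i₁ (ι₁-injective J₁ J₂ p p-inj) a b)
                                (fibreCount-≤1 m2 A₂ i₂ (ι₂-injective J₁ J₂ p) a b)

  gluedAdj-sym : ∀ a b → Ag a b ≡ Ag b a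
  gluedAdj-sym a b = cong (_≡ᵇ 1) (sym (cong₂ ℕ._+_
    (fibreCount-transpose m1 A₁ (Graph.adj-sym J₁) i₁ a b)
    (fibreCount-transpose m2 A₂ (Graph.adj-sym J₂) i₂ a b)))

  module _ (ψ : Fin G → Fin n) (ψ-inj : Injective ψ) where

    ψ∘i₁-injective : Injective (ψ ∘ i₁)
    ψ∘i₁-injective u v = ι₁-injective J₁ J₂ p p-inj u v ∘ ψ-inj _ _

    ψ∘i₂-injective : Injective (ψ ∘ i₂)
    ψ∘i₂-injective u v = ι₂-injective J₁ J₂ p u v ∘ ψ-inj _ _

    N₁ N₂ Ng : Fin n → Fin n → ℕ
    N₁ = fibreCount m1 A₁ (ψ ∘ i₁)
    N₂ = fibreCount m2 A₂ (ψ ∘ i₂)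
    Ng = fibreCount G Ag ψ

    fibre-parity-outside : ∀ c d → (∀ a → ψ a ≢ c) ⊎ (∀ b → ψ b ≢ d) →
      z c d ^ (N₁ c d ℕ.+ N₂ c d) ≈ z c d ^ Ng c d
    fibre-parity-outside c d outside = reflexive (cong (z c d ^_) (trans
      (cong₂ ℕ._+_ (fibreCount-outside m1 A₁ (ψ ∘ i₁) c d (restrict i₁))
                   (fibreCount-outside m2 A₂ (ψ ∘ i₂) c d (restrict i₂)))
      (sym (fibreCount-outside G Ag ψ c d outside))))
      where
      restrict : {k : ℕ} (ι : Fin k → Fin G) → (∀ u → ψ (ι u) ≢ c) ⊎ (∀ v → ψ (ι v) ≢ d)
      restrict ι = Sum.map (_∘ ι) (_∘ ι) outside

    fibre-parity : ∀ c d → z c d ^ (N₁ c d ℕ.+ N₂ c d) ≈ z c d ^ Ng c d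
    fibre-parity c d with any? (λ a → ψ a ≟ c) | any? (λ b → ψ b ≟ d)
    ... | yes (a , refl) | yes (b , refl) = begin
      z (ψ a) (ψ b) ^ (N₁ (ψ a) (ψ b) ℕ.+ N₂ (ψ a) (ψ b))
        ≡⟨ cong (z (ψ a) (ψ b) ^_) (cong₂ ℕ._+_ (fibreCount-∘ m1 A₁ ψ ψ-inj i₁ a b)
                                                 (fibreCount-∘ m2 A₂ ψ ψ-inj i₂ a b)) ⟩
      z (ψ a) (ψ b) ^ multiplicity J₁ J₂ p a b
        ≈⟨ parity (z (ψ a) (ψ b)) (z-square _ _) _ (multiplicity≤2 a b) ⟩
      z (ψ a) (ψ b) ^ indicator (Ag a b)
        ≡⟨ cong (z (ψ a) (ψ b) ^_) (sym (trans (fibreCount-∘ G Ag ψ ψ-inj id a b) (fibreCount-id G Ag a b))) ⟩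
      z (ψ a) (ψ b) ^ Ng (ψ a) (ψ b) ∎
    ... | no c-missed | _           = fibre-parity-outside c d (inj₁ (λ a ψa≡c → c-missed (a , ψa≡c)))
    ... | yes _       | no d-missed = fibre-parity-outside c d (inj₂ (λ b ψb≡d → d-missed (b , ψb≡d)))

    gluing-multiplicative : edgeProd R n x G Ag ψ ≈ edgeProd R n x m1 A₁ (ψ ∘ i₁) * edgeProd R n x m2 A₂ (ψ ∘ i₂)
    gluing-multiplicative = begin
      edgeProd R n x G Ag ψ
        ≈⟨ edgeProd-fibres n x x-sym G Ag gluedAdj-sym ψ ψ-inj ⟩
      ∏∏ n (λ c d → z c d ^ Ng c d)
        ≈⟨ ∏∏-cong n (λ c d → ≈-sym (fibre-parity c d)) ⟩
      ∏∏ n (λ c d → z c d ^ (N₁ c d ℕ.+ N₂ c d))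
        ≈⟨ ∏∏-cong n (λ c d → ^-homo-* (z c d) (N₁ c d) (N₂ c d)) ⟩
      ∏∏ n (λ c d → z c d ^ N₁ c d * z c d ^ N₂ c d)
        ≈⟨ ∏∏-* n _ _ ⟩
      ∏∏ n (λ c d → z c d ^ N₁ c d) * ∏∏ n (λ c d → z c d ^ N₂ c d)
        ≈⟨ ≈-sym (*-cong (edgeProd-fibres n x x-sym m1 A₁ (Graph.adj-sym J₁) (ψ ∘ i₁) ψ∘i₁-injective)
                         (edgeProd-fibres n x x-sym m2 A₂ (Graph.adj-sym J₂) (ψ ∘ i₂) ψ∘i₂-injective)) ⟩
      edgeProd R n x m1 A₁ (ψ ∘ i₁) * edgeProd R n x m2 A₂ (ψ ∘ i₂) ∎

witness : {A : Set} {P : A → Set} → Dec (∃ P) → Maybe A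
witness (yes (a , _)) = just a
witness (no _)        = nothing

module _ {A : Set} {P : A → Set} where

  witness-just : (d : Dec (∃ P)) {a : A} → witness d ≡ just a → P a
  witness-just (yes (a , pa)) refl = pa

  witness-unique : (d : Dec (∃ P)) → (∀ a a' → P a → P a' → a ≡ a') → {a : A} → P a → witness d ≡ just a
  witness-unique (yes (a' , pa')) unique pa = cong just (unique _ _ pa' pa)
  witness-unique (no ¬∃)          unique pa = ⊥-elim (¬∃ (_ , pa))

  witness-none : (d : Dec (∃ P)) → (∀ a → ¬ P a) → witness d ≡ nothing
  witness-none (yes (a , pa)) ¬P = ⊥-elim (¬P a pa)
  witness-none (no _)         ¬P = refl

module Correspondence (J₁ J₂ : Graph) {n : ℕ}
  (φ₁ : Fin (Graph.size J₁) → Fin n) (φ₂ : Fin (Graph.size J₂) → Fin n) where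

  m1 m2 : ℕ
  m1 = Graph.size J₁
  m2 = Graph.size J₂

  matching : Fin m1 → Maybe (Fin m2)
  matching v = witness (any? (λ w → φ₂ w ≟ φ₁ v))

  matching-sound : ∀ {v w} → matching v ≡ just w → φ₂ w ≡ φ₁ v
  matching-sound {v} = witness-just (any? (λ w → φ₂ w ≟ φ₁ v))

  matching-complete : Injective φ₂ → ∀ {v w} → φ₂ w ≡ φ₁ v → matching v ≡ just w
  matching-complete φ₂-inj {v} =
    witness-unique (any? (λ w → φ₂ w ≟ φ₁ v)) λ w w' e e' → φ₂-inj w w' (trans e (sym e'))

  matching-forced : (p : Fin m1 → Maybe (Fin m2)) (ψ : Fin (gluedSize J₁ J₂ p) → Fin n) → Injective ψ →
    φ₁ ≗ ψ ∘ ι₁ J₁ J₂ p → φ₂ ≗ ψ ∘ ι₂ J₁ J₂ p → p ≗ matching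
  matching-forced p ψ ψ-inj e₁ e₂ v with p v in pv
  ... | just w  = sym (matching-complete φ₂-inj (trans (e₂ w) (trans same-vertex (sym (e₁ v)))))
    where
    φ₂-inj : Injective φ₂
    φ₂-inj w w' e = ι₂-injective J₁ J₂ p w w' (ψ-inj _ _ (trans (sym (e₂ w)) (trans e (e₂ w'))))
    same-vertex : ψ (ι₂ J₁ J₂ p w) ≡ ψ (ι₁ J₁ J₂ p v)
    same-vertex = cong (ψ ∘ join m2 (unmatched p)) (sym (glue₀-matched p v w pv))
  ... | nothing = sym (witness-none (any? (λ w → φ₂ w ≟ φ₁ v)) unmatched-v)
    where
    unmatched-v : ∀ w → φ₂ w ≢ φ₁ v
    unmatched-v w φ₂w≡φ₁v = case trans (sym (glue₀-inj₁ p v w (sym same-vertex))) pv of λ ()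
      where
      same-vertex : inj₁ w ≡ glue₀ p v
      same-vertex = join-injective m2 (unmatched p) _ _ (ψ-inj _ _ (trans (sym (e₂ w)) (trans φ₂w≡φ₁v (e₁ v))))

  matching-pinjective : Injective φ₁ → (p : Fin m1 → Maybe (Fin m2)) → p ≗ matching → PInjective p
  matching-pinjective φ₁-inj p p≗matching v v' w pv pv' = φ₁-inj v v' (trans
    (sym (matching-sound (trans (sym (p≗matching v)) pv)))
    (matching-sound (trans (sym (p≗matching v')) pv')))

  module Amalgamation (p : Fin m1 → Maybe (Fin m2)) (p≗matching : p ≗ matching)
                      (φ₁-inj : Injective φ₁) (φ₂-inj : Injective φ₂) where

    vertex : Fin m2 ⊎ Fin (unmatched p) → Fin (gluedSize J₁ J₂ p)
    vertex = join m2 (unmatched p)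

    amalgam : Fin (gluedSize J₁ J₂ p) → Fin n
    amalgam a = [ φ₂ , φ₁ ∘ unmatchedVertex p ]′ (splitAt m2 a)

    amalgam-ι₁ : ∀ v → amalgam (ι₁ J₁ J₂ p v) ≡ φ₁ v
    amalgam-ι₁ v rewrite splitAt-join m2 (unmatched p) (glue₀ p v) with glue₀ p v in g
    ... | inj₁ w = matching-sound (trans (sym (p≗matching v)) (glue₀-inj₁ p v w g))
    ... | inj₂ k = cong φ₁ (sym (glue₀-inj₂ p v k g))

    amalgam-ι₂ : ∀ w → amalgam (ι₂ J₁ J₂ p w) ≡ φ₂ w
    amalgam-ι₂ w rewrite splitAt-join m2 (unmatched p) (inj₁ w) = refl

    from-split : ∀ a {s} → splitAt m2 a ≡ s → a ≡ vertex s
    from-split a e = trans (sym (join-splitAt m2 (unmatched p) a)) (cong vertex e)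

    amalgam-unique : (ψ : Fin (gluedSize J₁ J₂ p) → Fin n) →
      φ₁ ≗ ψ ∘ ι₁ J₁ J₂ p → φ₂ ≗ ψ ∘ ι₂ J₁ J₂ p → ψ ≗ amalgam
    amalgam-unique ψ e₁ e₂ a with splitAt m2 a in s
    ... | inj₁ w = trans (cong ψ (from-split a s)) (sym (e₂ w))
    ... | inj₂ k = trans (cong ψ (trans (from-split a s) (cong vertex (sym (glue₀-unmatchedVertex p k)))))
                         (sym (e₁ (unmatchedVertex p k)))

    unmatched-unseen : ∀ w k → φ₂ w ≢ φ₁ (unmatchedVertex p k)
    unmatched-unseen w k e =
      case trans (sym (glue₀-matched p (unmatchedVertex p k) w matched)) (glue₀-unmatchedVertex p k) of λ ()
      where
      matched : p (unmatchedVertex p k) ≡ just w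
      matched = trans (p≗matching _) (matching-complete φ₂-inj e)

    amalgam-injective : Injective amalgam
    amalgam-injective a b e with splitAt m2 a in sa | splitAt m2 b in sb
    ... | inj₁ w | inj₁ w' =
      trans (from-split a sa) (trans (cong (vertex ∘ inj₁) (φ₂-inj w w' e)) (sym (from-split b sb)))
    ... | inj₂ k | inj₂ k' =
      trans (from-split a sa) (trans (cong (vertex ∘ inj₂) same) (sym (from-split b sb)))
      where
      same : k ≡ k'
      same = inj₂-injective (trans (sym (glue₀-unmatchedVertex p k))
               (trans (cong (glue₀ p) (φ₁-inj _ _ e)) (glue₀-unmatchedVertex p k')))
    ... | inj₁ w | inj₂ k = ⊥-elim (unmatched-unseen w k e)
    ... | inj₂ k | inj₁ w = ⊥-elim (unmatched-unseen w k (sym e))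

module Assembly {c ℓ : Level} (R : CommutativeRing c ℓ) {n : ℕ} (x : Fin n → Fin n → CommutativeRing.Carrier R)
  (x-sym : ∀ a b → CommutativeRing._≈_ R (x a b) (x b a))
  (x-sq : ∀ a b → a ≢ b → CommutativeRing._≈_ R (CommutativeRing._*_ R (x a b) (x a b)) (CommutativeRing.1# R))
  (J₁ J₂ : Graph) where
  open CommutativeRing R hiding (zero) renaming (refl to ≈-refl; sym to ≈-sym; trans to ≈-trans)
  open BigOperators R
  open EdgeProducts R using (edgeProd-cong)
  open import Relation.Binary.Reasoning.Setoid setoid

  m1 m2 : ℕ
  m1 = Graph.size J₁
  m2 = Graph.size J₂

  points : List (Fin n)
  points = allFin n
  partialValues : List (Maybe (Fin m2))
  partialValues = nothing ∷ map just (allFin m2)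

  term : (J : Graph) → (Fin (Graph.size J) → Fin n) → Carrier
  term J φ = guard (injective? φ) (edgeProd R n x (Graph.size J) (Graph.adj J) φ)

  gluedTerm : (p : Fin m1 → Maybe (Fin m2)) → (Fin (gluedSize J₁ J₂ p) → Fin n) → Carrier
  gluedTerm p ψ =
    guard (pinjective? p) (guard (injective? ψ) (edgeProd R n x (gluedSize J₁ J₂ p) (gluedAdj J₁ J₂ p) ψ))

  restricts₁? : (p : Fin m1 → Maybe (Fin m2)) (ψ : Fin (gluedSize J₁ J₂ p) → Fin n) (φ₁ : Fin m1 → Fin n) →
    Dec (φ₁ ≗ ψ ∘ ι₁ J₁ J₂ p)
  restricts₁? p ψ φ₁ = all? (λ v → φ₁ v ≟ ψ (ι₁ J₁ J₂ p v))

  restricts₂? : (p : Fin m1 → Maybe (Fin m2)) (ψ : Fin (gluedSize J₁ J₂ p) → Fin n) (φ₂ : Fin m2 → Fin n) →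
    Dec (φ₂ ≗ ψ ∘ ι₂ J₁ J₂ p)
  restricts₂? p ψ φ₂ = all? (λ w → φ₂ w ≟ ψ (ι₂ J₁ J₂ p w))

  restricted : (p : Fin m1 → Maybe (Fin m2)) → (Fin (gluedSize J₁ J₂ p) → Fin n) →
    (Fin m1 → Fin n) → (Fin m2 → Fin n) → Carrier
  restricted p ψ φ₁ φ₂ = guard (restricts₁? p ψ φ₁) (guard (restricts₂? p ψ φ₂) (gluedTerm p ψ))

  Σ[φ₁,φ₂] : ((Fin m1 → Fin n) → (Fin m2 → Fin n) → Carrier) → Carrier
  Σ[φ₁,φ₂] f = sumFuns R m1 points (λ φ₁ → sumFuns R m2 points (f φ₁))

  Σ[φ₁,φ₂]-cong : {f g : (Fin m1 → Fin n) → (Fin m2 → Fin n) → Carrier} →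
    (∀ φ₁ φ₂ → f φ₁ φ₂ ≈ g φ₁ φ₂) → Σ[φ₁,φ₂] f ≈ Σ[φ₁,φ₂] g
  Σ[φ₁,φ₂]-cong e = sumFuns-cong m1 points (λ φ₁ → sumFuns-cong m2 points (e φ₁))

  Σ[p,ψ] : ((p : Fin m1 → Maybe (Fin m2)) → (Fin (gluedSize J₁ J₂ p) → Fin n) → Carrier) → Carrier
  Σ[p,ψ] f = sumFuns R m1 partialValues (λ p → sumFuns R (gluedSize J₁ J₂ p) points (f p))

  product-expansion : j̃ R J₁ n x * j̃ R J₂ n x ≈ Σ[φ₁,φ₂] (λ φ₁ φ₂ → term J₁ φ₁ * term J₂ φ₂)
  product-expansion = ≈-trans (sumFuns-*ʳ m1 points _ (term J₁))
                              (sumFuns-cong m1 points (λ φ₁ → sumFuns-*ˡ m2 points (term J₁ φ₁) (term J₂)))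

  restriction-delta : ∀ p ψ → Σ[φ₁,φ₂] (restricted p ψ) ≈ gluedTerm p ψ
  restriction-delta p ψ =
    sumFuns-delta m1 points (allFin-sumsDeltas n) (ψ ∘ ι₁ J₁ J₂ p) _ _
      (λ φ₁ e₁ → sumFuns-delta m2 points (allFin-sumsDeltas n) (ψ ∘ ι₂ J₁ J₂ p) _ _
         (λ φ₂ e₂ → ≈-trans (guard-yes (restricts₁? p ψ φ₁) e₁) (guard-yes (restricts₂? p ψ φ₂) e₂))
         (λ φ₂ ¬e₂ → ≈-trans (guard-yes (restricts₁? p ψ φ₁) e₁) (guard-zero (restricts₂? p ψ φ₂) (⊥-elim ∘ ¬e₂))))
      (λ φ₁ ¬e₁ → sumFuns-zero m2 points (λ φ₂ → guard-zero (restricts₁? p ψ φ₁) (⊥-elim ∘ ¬e₁)))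

  glueSum-expansion : glueSum R J₁ J₂ n x ≈ Σ[φ₁,φ₂] (λ φ₁ φ₂ → Σ[p,ψ] (λ p ψ → restricted p ψ φ₁ φ₂))
  glueSum-expansion = begin
    glueSum R J₁ J₂ n x
      ≈⟨ sumFuns-cong m1 partialValues (λ p → guard-sumFuns (pinjective? p) (gluedSize J₁ J₂ p) points _) ⟩
    Σ[p,ψ] gluedTerm
      ≈⟨ sumFuns-cong m1 partialValues (λ p →
           sumFuns-cong (gluedSize J₁ J₂ p) points (≈-sym ∘ restriction-delta p)) ⟩
    Σ[p,ψ] (λ p ψ → Σ[φ₁,φ₂] (restricted p ψ))
      ≈⟨ sumFuns-cong m1 partialValues (λ p → ≈-trans (sumFuns-comm (gluedSize J₁ J₂ p) points m1 points _)
           (sumFuns-cong m1 points (λ φ₁ → sumFuns-comm (gluedSize J₁ J₂ p) points m2 points _))) ⟩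
    sumFuns R m1 partialValues (λ p →
      Σ[φ₁,φ₂] (λ φ₁ φ₂ → sumFuns R (gluedSize J₁ J₂ p) points (λ ψ → restricted p ψ φ₁ φ₂)))
      ≈⟨ ≈-trans (sumFuns-comm m1 partialValues m1 points _)
                 (sumFuns-cong m1 points (λ φ₁ → sumFuns-comm m1 partialValues m2 points _)) ⟩
    Σ[φ₁,φ₂] (λ φ₁ φ₂ → Σ[p,ψ] (λ p ψ → restricted p ψ φ₁ φ₂)) ∎

  restricted-value : ∀ p ψ φ₁ φ₂ → φ₁ ≗ ψ ∘ ι₁ J₁ J₂ p → φ₂ ≗ ψ ∘ ι₂ J₁ J₂ p → PInjective p → Injective ψ →
    restricted p ψ φ₁ φ₂ ≈ edgeProd R n x (gluedSize J₁ J₂ p) (gluedAdj J₁ J₂ p) ψ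
  restricted-value p ψ φ₁ φ₂ e₁ e₂ p-inj ψ-inj =
    ≈-trans (guard-yes (restricts₁? p ψ φ₁) e₁) (≈-trans (guard-yes (restricts₂? p ψ φ₂) e₂)
      (≈-trans (guard-yes (pinjective? p) p-inj) (guard-yes (injective? ψ) ψ-inj)))

  restricted-zero : ∀ p ψ φ₁ φ₂ →
    (φ₁ ≗ ψ ∘ ι₁ J₁ J₂ p → φ₂ ≗ ψ ∘ ι₂ J₁ J₂ p → PInjective p → Injective ψ → ⊥) → restricted p ψ φ₁ φ₂ ≈ 0#
  restricted-zero p ψ φ₁ φ₂ impossible =
    guard-zero (restricts₁? p ψ φ₁) λ e₁ → guard-zero (restricts₂? p ψ φ₂) λ e₂ →
    guard-zero (pinjective? p) λ p-inj → guard-zero (injective? ψ) λ ψ-inj → ⊥-elim (impossible e₁ e₂ p-inj ψ-inj)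

  fibre-sum-noninjective : ∀ φ₁ φ₂ → ¬ Injective φ₁ ⊎ ¬ Injective φ₂ →
    Σ[p,ψ] (λ p ψ → restricted p ψ φ₁ φ₂) ≈ 0#
  fibre-sum-noninjective φ₁ φ₂ noninjective =
    sumFuns-zero m1 partialValues λ p → sumFuns-zero _ points λ ψ →
    restricted-zero p ψ φ₁ φ₂ (restrictions-injective p ψ noninjective)
    where
    restrictions-injective : ∀ p ψ → ¬ Injective φ₁ ⊎ ¬ Injective φ₂ →
      φ₁ ≗ ψ ∘ ι₁ J₁ J₂ p → φ₂ ≗ ψ ∘ ι₂ J₁ J₂ p → PInjective p → Injective ψ → ⊥
    restrictions-injective p ψ (inj₁ ¬inj₁) e₁ e₂ p-inj ψ-inj =
      ¬inj₁ (λ u v e → ι₁-injective J₁ J₂ p p-inj u v (ψ-inj _ _ (trans (sym (e₁ u)) (trans e (e₁ v)))))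
    restrictions-injective p ψ (inj₂ ¬inj₂) e₁ e₂ p-inj ψ-inj =
      ¬inj₂ (λ u v e → ι₂-injective J₁ J₂ p u v (ψ-inj _ _ (trans (sym (e₂ u)) (trans e (e₂ v)))))

  fibre-sum-injective : ∀ φ₁ φ₂ → Injective φ₁ → Injective φ₂ → Σ[p,ψ] (λ p ψ → restricted p ψ φ₁ φ₂) ≈
    edgeProd R n x m1 (Graph.adj J₁) φ₁ * edgeProd R n x m2 (Graph.adj J₂) φ₂
  fibre-sum-injective φ₁ φ₂ φ₁-inj φ₂-inj =
    sumFuns-delta m1 partialValues (maybeFin-sumsDeltas m2) matching _ _ at-matching off-matching
    where
    open Correspondence J₁ J₂ φ₁ φ₂ using (matching; matching-forced; matching-pinjective; module Amalgamation)

    at-matching : ∀ p → p ≗ matching → sumFuns R (gluedSize J₁ J₂ p) points (λ ψ → restricted p ψ φ₁ φ₂) ≈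
      edgeProd R n x m1 (Graph.adj J₁) φ₁ * edgeProd R n x m2 (Graph.adj J₂) φ₂
    at-matching p p≗matching =
      sumFuns-delta (gluedSize J₁ J₂ p) points (allFin-sumsDeltas n) amalgam _ _ at-amalgam off-amalgam
      where
      open Amalgamation p p≗matching φ₁-inj φ₂-inj
      p-inj : PInjective p
      p-inj = matching-pinjective φ₁-inj p p≗matching

      at-amalgam : ∀ ψ → ψ ≗ amalgam → restricted p ψ φ₁ φ₂ ≈
        edgeProd R n x m1 (Graph.adj J₁) φ₁ * edgeProd R n x m2 (Graph.adj J₂) φ₂
      at-amalgam ψ ψ≗amalgam = begin
        restricted p ψ φ₁ φ₂
          ≈⟨ restricted-value p ψ φ₁ φ₂ e₁ e₂ p-inj ψ-inj ⟩
        edgeProd R n x (gluedSize J₁ J₂ p) (gluedAdj J₁ J₂ p) ψ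
          ≈⟨ Gluing.gluing-multiplicative R x x-sym x-sq J₁ J₂ p p-inj ψ ψ-inj ⟩
        edgeProd R n x m1 (Graph.adj J₁) (ψ ∘ ι₁ J₁ J₂ p) * edgeProd R n x m2 (Graph.adj J₂) (ψ ∘ ι₂ J₁ J₂ p)
          ≈⟨ *-cong (edgeProd-cong n x m1 (Graph.adj J₁) (sym ∘ e₁))
                    (edgeProd-cong n x m2 (Graph.adj J₂) (sym ∘ e₂)) ⟩
        edgeProd R n x m1 (Graph.adj J₁) φ₁ * edgeProd R n x m2 (Graph.adj J₂) φ₂ ∎
        where
        e₁ : φ₁ ≗ ψ ∘ ι₁ J₁ J₂ p
        e₁ v = sym (trans (ψ≗amalgam _) (amalgam-ι₁ v))
        e₂ : φ₂ ≗ ψ ∘ ι₂ J₁ J₂ p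
        e₂ w = sym (trans (ψ≗amalgam _) (amalgam-ι₂ w))
        ψ-inj : Injective ψ
        ψ-inj a b e = amalgam-injective a b (trans (sym (ψ≗amalgam a)) (trans e (ψ≗amalgam b)))

      off-amalgam : ∀ ψ → ¬ (ψ ≗ amalgam) → restricted p ψ φ₁ φ₂ ≈ 0#
      off-amalgam ψ ψ≉amalgam = restricted-zero p ψ φ₁ φ₂ (λ e₁ e₂ _ _ → ψ≉amalgam (amalgam-unique ψ e₁ e₂))

    off-matching : ∀ p → ¬ (p ≗ matching) →
      sumFuns R (gluedSize J₁ J₂ p) points (λ ψ → restricted p ψ φ₁ φ₂) ≈ 0#
    off-matching p p≉matching = sumFuns-zero _ points λ ψ →
      restricted-zero p ψ φ₁ φ₂ (λ e₁ e₂ _ ψ-inj → p≉matching (matching-forced p ψ ψ-inj e₁ e₂))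

  fibre-sum : ∀ φ₁ φ₂ → Σ[p,ψ] (λ p ψ → restricted p ψ φ₁ φ₂) ≈ term J₁ φ₁ * term J₂ φ₂
  fibre-sum φ₁ φ₂ with injective? φ₁ | injective? φ₂
  ... | yes φ₁-inj | yes φ₂-inj = ≈-trans (fibre-sum-injective φ₁ φ₂ φ₁-inj φ₂-inj)
    (≈-sym (*-cong (guard-yes (injective? φ₁) φ₁-inj) (guard-yes (injective? φ₂) φ₂-inj)))
  ... | no ¬φ₁-inj | _          = ≈-trans (fibre-sum-noninjective φ₁ φ₂ (inj₁ ¬φ₁-inj))
    (≈-sym (≈-trans (*-congʳ (guard-zero (injective? φ₁) (⊥-elim ∘ ¬φ₁-inj))) (zeroˡ _)))
  ... | yes _      | no ¬φ₂-inj = ≈-trans (fibre-sum-noninjective φ₁ φ₂ (inj₂ ¬φ₂-inj))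
    (≈-sym (≈-trans (*-congˡ (guard-zero (injective? φ₂) (⊥-elim ∘ ¬φ₂-inj))) (zeroʳ _)))

mainTheorem4 : {c ℓ : Level} (R : CommutativeRing c ℓ) →
    let open CommutativeRing R in
    (n : ℕ) (x : Fin n → Fin n → Carrier) →
    (∀ a b → x a b ≈ x b a) →
    (∀ a b → a ≢ b → x a b * x a b ≈ 1#) →
    (J₁ J₂ : Graph) →
    j̃ R J₁ n x * j̃ R J₂ n x ≈ glueSum R J₁ J₂ n x
mainTheorem4 R n x x-sym x-sq J₁ J₂ = begin
  j̃ R J₁ n x * j̃ R J₂ n x
    ≈⟨ product-expansion ⟩
  Σ[φ₁,φ₂] (λ φ₁ φ₂ → term J₁ φ₁ * term J₂ φ₂)
    ≈⟨ Σ[φ₁,φ₂]-cong (λ φ₁ φ₂ → ≈-sym (fibre-sum φ₁ φ₂)) ⟩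
  Σ[φ₁,φ₂] (λ φ₁ φ₂ → Σ[p,ψ] (λ p ψ → restricted p ψ φ₁ φ₂))
    ≈⟨ ≈-sym glueSum-expansion ⟩
  glueSum R J₁ J₂ n x ∎
  where
  open CommutativeRing R using (_*_; setoid) renaming (sym to ≈-sym)
  open Assembly R x x-sym x-sq J₁ J₂
  open import Relation.Binary.Reasoning.Setoid setoid
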